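{- Let $D=(d_1,\ldots,d_n)$, with $d_1\ge d_2\ge\cdots\ge d_n$, be a forcibly unicyclic graphic sequence with $n\ge 6$. Then $d_4\le 2$.
   Context: All graphs are simple. A realization of a sequence $D=(d_1,\ldots,d_n)$ is a simple graph with vertices $v_1,\ldots,v_n$ with $\deg(v_i)=d_i$; $D$ is graphic if it has a realization. A graphic sequence is forcibly unicyclic if every realization of it is connected and has exactly $n$ edges. -}

module Defs where

open import Data.Nat using (ℕ; zero; suc; _+_; _<_; _≤_; _<?_)
open import Data.Bool using (Bool; true; false; if_then_else_; _∧_)
open import Data.Fin using (Fin; toℕ)
import Data.Fin as Fin
open import Data.Product using (Σ; _×_; ∃)
open import Relation.Binary.PropositionalEquality using (_≡_)
open import Relation.Nullary.Decidable using (⌊_⌋)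
open import Relation.Binary.Construct.Closure.ReflexiveTransitive using (Star)

count : ∀ {n} → (Fin n → Bool) → ℕ
count {zero}  p = 0
count {suc n} p = (if p Fin.zero then 1 else 0) + count (λ i → p (Fin.suc i))

sumFin : ∀ {n} → (Fin n → ℕ) → ℕ
sumFin {zero}  f = 0
sumFin {suc n} f = f Fin.zero + sumFin (λ i → f (Fin.suc i))

-- a simple graph on vertex set Fin n (vertex v_i is i)
record Graph (n : ℕ) : Set where
  field
    adj    : Fin n → Fin n → Bool
    sym    : ∀ i j → adj i j ≡ adj j i
    irrefl : ∀ i → adj i i ≡ false
open Graph public

degree : ∀ {n} → Graph n → Fin n → ℕ
degree G i = count (adj G i)

edgeCount : ∀ {n} → Graph n → ℕ
edgeCount {n} G = sumFin (λ i → count (λ j → ⌊ toℕ i <? toℕ j ⌋ ∧ adj G i j))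

Adjacent : ∀ {n} → Graph n → Fin n → Fin n → Set
Adjacent G i j = adj G i j ≡ true

Connected : ∀ {n} → Graph n → Set
Connected G = ∀ i j → Star (Adjacent G) i j

Realizes : ∀ {n} → Graph n → (Fin n → ℕ) → Set
Realizes G D = ∀ i → degree G i ≡ D i

Graphic : ∀ {n} → (Fin n → ℕ) → Set
Graphic {n} D = Σ (Graph n) λ G → Realizes G D

ForciblyUnicyclic : ∀ {n} → (Fin n → ℕ) → Set
ForciblyUnicyclic {n} D =
  Graphic D × (∀ (G : Graph n) → Realizes G D → Connected G × edgeCount G ≡ n)

NonIncreasing : ∀ {n} → (Fin n → ℕ) → Set
NonIncreasing D = ∀ i j → toℕ i ≤ toℕ j → D j ≤ D i

-- Suppose d₄ ≥ 3, so some four vertices (hubs) p, f₁, f₂, f₃ have degree at least 3.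
-- Write ℓ(s) for the number of leaves adjacent to s. Since realizations are connected and have
-- n edges, Σ dᵥ = 2n forces Σ ℓ(s) = Σ (d_s ∸ 2). Two leaves with distinct neighbours a, b force
-- a ~ b: otherwise a 2-switch splits the two leaves off as a K₂, leaving a disconnected
-- realization. Pick a realization maximising ℓ(p), so that no 2-switch moves a leaf onto p.
-- Casing on the number of non-leaf neighbours of p, either ℓ(s) ≤ d_s ∸ 2 holds with enough
-- strict inequalities to contradict the identity above, or p, its non-leaf neighbours and all
-- leaves form a union of components avoiding some fᵢ, contradicting connectivity.

module Submission where

open import Defs renaming (sym to adj-sym; irrefl to adj-irrefl)
open import Data.Bool using (Bool; true; false; if_then_else_; _∧_; _∨_; not)
open import Data.Bool.Properties
  using (T-≡; ¬-not; ∧-comm; ∧-zeroʳ; ∧-identityʳ; ∨-zeroʳ; ∨-comm) renaming (_≟_ to _≟ᵇ_)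
open import Data.Empty using (⊥; ⊥-elim)
open import Data.Fin using (Fin; zero; suc; toℕ; _≟_; _↑ˡ_)
open import Data.Fin.Patterns using (0F; 1F; 2F; 3F)
open import Data.Fin.Properties using (toℕ-injective; toℕ-↑ˡ; ↑ˡ-injective; toℕ≤pred[n])
open import Data.Nat using (ℕ; zero; suc; _+_; _∸_; _≤_; _<_; z≤n; s≤s; _≤?_; _<?_; _≡ᵇ_)
open import Data.Nat.Properties hiding (_≟_)
open import Algebra.Properties.CommutativeMonoid.Sum +-0-commutativeMonoid
  using (sum; ∑-distrib-+; ∑-comm)
open import Data.Product using (∃; _×_; _,_; proj₁; proj₂)
open import Data.Sum using (_⊎_; inj₁; inj₂)
open import Function using (_∘_; case_of_; Equivalence)
open import Relation.Binary.Construct.Closure.ReflexiveTransitive using (Star; ε; _◅_)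
open import Relation.Binary.PropositionalEquality
open import Relation.Nullary using (¬_; Dec; yes; no; does)
open import Relation.Nullary.Decidable using (⌊_⌋; dec-true; dec-false)

_==_ : ∀ {n} → Fin n → Fin n → Bool
i == j = does (i ≟ j)

==-refl : ∀ {n} (i : Fin n) → (i == i) ≡ true
==-refl i = dec-true (i ≟ i) refl

==-≢ : ∀ {n} {i j : Fin n} → i ≢ j → (i == j) ≡ false
==-≢ {i = i} {j} = dec-false (i ≟ j)

==⇒≡ : ∀ {n} {i j : Fin n} → (i == j) ≡ true → i ≡ j
==⇒≡ {i = i} {j} with i ≟ j
... | yes i≡j = λ _ → i≡j
... | no  _   = λ ()

true≢false : true ≢ false
true≢false ()

∧-true⁻ : ∀ {x y} → x ∧ y ≡ true → x ≡ true × y ≡ true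
∧-true⁻ {true} {true} _ = refl , refl

∧-true⁺ : ∀ {x y} → x ≡ true → y ≡ true → x ∧ y ≡ true
∧-true⁺ refl refl = refl

∨-true⁻ : ∀ {x y} → x ∨ y ≡ true → x ≡ true ⊎ y ≡ true
∨-true⁻ {true}  _   = inj₁ refl
∨-true⁻ {false} y≡t = inj₂ y≡t

not-true⁻ : ∀ {x} → not x ≡ true → x ≡ false
not-true⁻ {false} _ = refl

not-true⁺ : ∀ {x} → x ≡ false → not x ≡ true
not-true⁺ refl = refl

module _ {n : ℕ} where

  erase : Fin n → (Fin n → Bool) → Fin n → Bool
  erase a p i = p i ∧ not (i == a)

  erase⁺ : ∀ p {a b} → p b ≡ true → b ≢ a → erase a p b ≡ true
  erase⁺ p pb b≢a = ∧-true⁺ pb (not-true⁺ (==-≢ b≢a))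

  erase-self : ∀ p a → erase a p a ≡ false
  erase-self p a rewrite ==-refl a = ∧-zeroʳ (p a)

  erase-other : ∀ p {a i} → i ≢ a → erase a p i ≡ p i
  erase-other p {i = i} i≢a rewrite ==-≢ i≢a = ∧-identityʳ (p i)

  erase⁻ : ∀ p {a b} → erase a p b ≡ true → p b ≡ true × b ≢ a
  erase⁻ p {a} {b} eb with ∧-true⁻ {p b} eb
  ... | pb , b≠a = pb , λ { refl → true≢false (trans (sym (==-refl b)) (not-true⁻ b≠a)) }

count-cong : ∀ {n} {p q : Fin n → Bool} → p ≗ q → count p ≡ count q
count-cong {zero}  _ = refl
count-cong {suc n} {p} {q} p≗q rewrite p≗q zero = cong (_ +_) (count-cong (p≗q ∘ suc))

count-false : ∀ {n} {p : Fin n → Bool} → (∀ i → p i ≡ false) → count p ≡ 0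
count-false {zero}  _ = refl
count-false {suc n} {p} p≡false rewrite p≡false zero = count-false (p≡false ∘ suc)

count≡0⇒false : ∀ {n} (p : Fin n → Bool) → count p ≡ 0 → ∀ i → p i ≡ false
count≡0⇒false {suc n} p c≡0 i with p zero in p₀
count≡0⇒false {suc n} p () i      | true
count≡0⇒false {suc n} p c≡0 zero    | false = p₀
count≡0⇒false {suc n} p c≡0 (suc i) | false = count≡0⇒false (p ∘ suc) c≡0 i

count≡0⊎witness : ∀ {n} (p : Fin n → Bool) → count p ≡ 0 ⊎ ∃ λ i → p i ≡ true
count≡0⊎witness {zero}  p = inj₁ refl
count≡0⊎witness {suc n} p with p zero in p₀ | count≡0⊎witness (p ∘ suc)
... | true  | _             = inj₂ (zero , p₀)
... | false | inj₁ c≡0      = inj₁ c≡0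
... | false | inj₂ (i , pi) = inj₂ (suc i , pi)

count-witness : ∀ {n} (p : Fin n → Bool) → 1 ≤ count p → ∃ λ i → p i ≡ true
count-witness p 1≤c with count≡0⊎witness p
... | inj₁ c≡0 = ⊥-elim (1+n≰n (subst (1 ≤_) c≡0 1≤c))
... | inj₂ w   = w

count-erase : ∀ {n} (p : Fin n → Bool) {a} → p a ≡ true → count p ≡ suc (count (erase a p))
count-erase {suc n} p {zero} pa rewrite pa =
  cong suc (count-cong (λ i → sym (∧-identityʳ (p (suc i)))))
count-erase {suc n} p {suc a} pa with p zero
... | true  = cong suc (count-erase (p ∘ suc) pa)
... | false = count-erase (p ∘ suc) pa

count-mono : ∀ {n} {p q : Fin n → Bool} → (∀ i → p i ≡ true → q i ≡ true) → count p ≤ count q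
count-mono {zero} _ = z≤n
count-mono {suc n} {p} {q} p⇒q with p zero in p₀ | q zero in q₀
... | true  | true  = s≤s (count-mono (p⇒q ∘ suc))
... | true  | false = ⊥-elim (true≢false (trans (sym (p⇒q zero p₀)) q₀))
... | false | true  = m≤n⇒m≤1+n (count-mono (p⇒q ∘ suc))
... | false | false = count-mono (p⇒q ∘ suc)

count-split : ∀ {n} (p q : Fin n → Bool) →
  count p ≡ count (λ i → p i ∧ q i) + count (λ i → p i ∧ not (q i))
count-split {zero}  p q = refl
count-split {suc n} p q with p zero | q zero
... | true  | true  = cong suc (count-split (p ∘ suc) (q ∘ suc))
... | true  | false = trans (cong suc (count-split (p ∘ suc) (q ∘ suc))) (sym (+-suc _ _))
... | false | _     = count-split (p ∘ suc) (q ∘ suc)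

count-pos : ∀ {n} (p : Fin n → Bool) {a} → p a ≡ true → 1 ≤ count p
count-pos p pa rewrite count-erase p pa = s≤s z≤n

count-erase-≤ : ∀ {n} (p : Fin n → Bool) a → count p ≤ suc (count (erase a p))
count-erase-≤ p a with p a in pa
... | true  = ≤-reflexive (count-erase p pa)
... | false = m≤n⇒m≤1+n (count-mono p⇒erase)
  where
  p⇒erase : ∀ i → p i ≡ true → erase a p i ≡ true
  p⇒erase i pi = erase⁺ p pi λ { refl → true≢false (trans (sym pi) pa) }

count≡1⇒unique : ∀ {n} (p : Fin n → Bool) → count p ≡ 1 →
  ∀ {a b} → p a ≡ true → p b ≡ true → b ≡ a
count≡1⇒unique p c≡1 {a} {b} pa pb with b ≟ a
... | yes b≡a = b≡a
... | no  b≢a = ⊥-elim (true≢false (trans (sym (erase⁺ p pb b≢a))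
      (count≡0⇒false (erase a p) (suc-injective (trans (sym (count-erase p pa)) c≡1)) b)))

count-≥2 : ∀ {n} (p : Fin n → Bool) {a b} → p a ≡ true → p b ≡ true → b ≢ a → 2 ≤ count p
count-≥2 p pa pb b≢a rewrite count-erase p pa = s≤s (count-pos (erase _ p) (erase⁺ p pb b≢a))

count-≥3 : ∀ {n} (p : Fin n → Bool) {a b c} → p a ≡ true → p b ≡ true → p c ≡ true →
  b ≢ a → c ≢ a → c ≢ b → 3 ≤ count p
count-≥3 p pa pb pc b≢a c≢a c≢b rewrite count-erase p pa =
  s≤s (count-≥2 (erase _ p) (erase⁺ p pb b≢a) (erase⁺ p pc c≢a) c≢b)

count-other : ∀ {n} (p : Fin n → Bool) a → 2 ≤ count p → ∃ λ b → p b ≡ true × b ≢ a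
count-other p a 2≤c =
  let b , eb = count-witness (erase a p) (≤-pred (≤-trans 2≤c (count-erase-≤ p a)))
  in b , erase⁻ p eb

count-others : ∀ {n} (p : Fin n → Bool) a → 3 ≤ count p →
  ∃ λ b → ∃ λ c → p b ≡ true × p c ≡ true × b ≢ a × c ≢ a × c ≢ b
count-others p a 3≤c =
  let 2≤c′ = ≤-pred (≤-trans 3≤c (count-erase-≤ p a))
      b , eb , _   = count-other (erase a p) a 2≤c′
      c , ec , c≢b = count-other (erase a p) b 2≤c′
      pb , b≢a = erase⁻ p eb
      pc , c≢a = erase⁻ p ec
  in b , c , pb , pc , b≢a , c≢a , c≢b

count-singleton : ∀ {n} (a : Fin n) → count (_== a) ≡ 1
count-singleton a = trans (count-erase (_== a) (==-refl a)) (cong suc (count-false only-a))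
  where
  only-a : ∀ i → erase a (_== a) i ≡ false
  only-a i with i ≟ a
  ... | yes _ = refl
  ... | no  _ = refl

count-exchange : ∀ {n} {p q : Fin n → Bool} {a b} →
  p a ≡ true → p b ≡ false → q a ≡ false → q b ≡ true →
  (∀ i → i ≢ a → i ≢ b → q i ≡ p i) → count q ≡ count p
count-exchange {p = p} {q} {a} {b} pa pb qa qb q≡p =
  trans (count-erase q qb) (trans (cong suc (count-cong agree)) (sym (count-erase p pa)))
  where
  agree : ∀ i → erase b q i ≡ erase a p i
  agree i with i ≟ a | i ≟ b
  ... | yes refl | _        rewrite qa = sym (∧-zeroʳ (p i))
  ... | no  _    | yes refl rewrite pb = ∧-zeroʳ (q i)
  ... | no  i≢a  | no  i≢b  rewrite q≡p i i≢a i≢b = refl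

sumFin≡sum : ∀ {n} (f : Fin n → ℕ) → sumFin f ≡ sum f
sumFin≡sum {zero}  f = refl
sumFin≡sum {suc n} f = cong (f zero +_) (sumFin≡sum (f ∘ suc))

sumFin-cong : ∀ {n} {f g : Fin n → ℕ} → f ≗ g → sumFin f ≡ sumFin g
sumFin-cong {zero}  _   = refl
sumFin-cong {suc n} f≗g = cong₂ _+_ (f≗g zero) (sumFin-cong (f≗g ∘ suc))

sumFin-mono : ∀ {n} {f g : Fin n → ℕ} → (∀ i → f i ≤ g i) → sumFin f ≤ sumFin g
sumFin-mono {zero}  _   = z≤n
sumFin-mono {suc n} f≤g = +-mono-≤ (f≤g zero) (sumFin-mono (f≤g ∘ suc))

sumFin-< : ∀ {n} {f g : Fin n → ℕ} → (∀ i → f i ≤ g i) → ∀ w → f w < g w → sumFin f < sumFin g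
sumFin-< f≤g zero    fw<gw = +-mono-<-≤ fw<gw (sumFin-mono (f≤g ∘ suc))
sumFin-< f≤g (suc w) fw<gw = +-mono-≤-< (f≤g zero) (sumFin-< (f≤g ∘ suc) w fw<gw)

sumFin-+ : ∀ {n} (f g : Fin n → ℕ) → sumFin (λ i → f i + g i) ≡ sumFin f + sumFin g
sumFin-+ f g = begin
  sumFin (λ i → f i + g i)  ≡⟨ sumFin≡sum (λ i → f i + g i) ⟩
  sum (λ i → f i + g i)     ≡⟨ ∑-distrib-+ f g ⟩
  sum f + sum g             ≡⟨ cong₂ _+_ (sumFin≡sum f) (sumFin≡sum g) ⟨
  sumFin f + sumFin g       ∎
  where open ≡-Reasoning

sumFin-comm : ∀ {m n} (f : Fin m → Fin n → ℕ) →
  sumFin (λ i → sumFin (f i)) ≡ sumFin (λ j → sumFin (λ i → f i j))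
sumFin-comm f = begin
  sumFin (λ i → sumFin (f i))           ≡⟨ sumFin-cong (sumFin≡sum ∘ f) ⟩
  sumFin (λ i → sum (f i))              ≡⟨ sumFin≡sum (λ i → sum (f i)) ⟩
  sum (λ i → sum (f i))                 ≡⟨ ∑-comm f ⟩
  sum (λ j → sum (λ i → f i j))         ≡⟨ sumFin≡sum (λ j → sum (λ i → f i j)) ⟨
  sumFin (λ j → sum (λ i → f i j))      ≡⟨ sumFin-cong (λ j → sumFin≡sum (λ i → f i j)) ⟨
  sumFin (λ j → sumFin (λ i → f i j))   ∎
  where open ≡-Reasoning

sumFin-2 : ∀ n → sumFin {n} (λ _ → 2) ≡ n + n
sumFin-2 zero    = refl
sumFin-2 (suc n) = cong suc (trans (cong suc (sumFin-2 n)) (sym (+-suc n n)))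

count≡sumFin : ∀ {n} (p : Fin n → Bool) → count p ≡ sumFin (λ i → if p i then 1 else 0)
count≡sumFin {zero}  p = refl
count≡sumFin {suc n} p = cong ((if p zero then 1 else 0) +_) (count≡sumFin (p ∘ suc))

count-transpose : ∀ {n} (M : Fin n → Fin n → Bool) →
  sumFin (λ i → count (M i)) ≡ sumFin (λ j → count (λ i → M i j))
count-transpose M = begin
  sumFin (λ i → count (M i))                                    ≡⟨ sumFin-cong (count≡sumFin ∘ M) ⟩
  sumFin (λ i → sumFin (λ j → if M i j then 1 else 0))          ≡⟨ sumFin-comm (λ i j → if M i j then 1 else 0) ⟩
  sumFin (λ j → sumFin (λ i → if M i j then 1 else 0))          ≡⟨ sumFin-cong (λ j → count≡sumFin (λ i → M i j)) ⟨
  sumFin (λ j → count (λ i → M i j))                            ∎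
  where open ≡-Reasoning

sumFin-<-despite-surplus : ∀ {n} {f g : Fin n → ℕ} {p w₁ w₂} →
  (∀ i → i ≢ p → f i ≤ g i) → f p ≤ suc (g p) →
  w₁ ≢ p → w₂ ≢ p → w₂ ≢ w₁ → f w₁ < g w₁ → f w₂ < g w₂ → sumFin f < sumFin g
sumFin-<-despite-surplus {n} {f} {g} {p} {w₁} {w₂} f≤g fp≤ w₁≢p w₂≢p w₂≢w₁ fw₁<gw₁ fw₂<gw₂ =
  +-cancelʳ-< 1 (sumFin f) (sumFin g) (begin-strict
    sumFin f + 1                   ≡⟨ cong (sumFin f +_) (sumFin-δ w₂) ⟨
    sumFin f + sumFin (δ w₂)       ≡⟨ sumFin-+ f (δ w₂) ⟨
    sumFin (λ i → f i + δ w₂ i)    <⟨ sumFin-< shifted w₁ shifted-strict ⟩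
    sumFin (λ i → g i + δ p i)     ≡⟨ sumFin-+ g (δ p) ⟩
    sumFin g + sumFin (δ p)        ≡⟨ cong (sumFin g +_) (sumFin-δ p) ⟩
    sumFin g + 1                   ∎)
  where
  open ≤-Reasoning
  δ : Fin n → Fin n → ℕ
  δ a i = if i == a then 1 else 0
  sumFin-δ : ∀ a → sumFin (δ a) ≡ 1
  sumFin-δ a = trans (sym (count≡sumFin (_== a))) (count-singleton a)
  shifted : ∀ i → f i + δ w₂ i ≤ g i + δ p i
  shifted i with i ≟ p | i ≟ w₂
  ... | yes refl | yes refl = ⊥-elim (w₂≢p refl)
  ... | yes refl | no _     rewrite +-identityʳ (f i) | +-comm (g i) 1 = fp≤
  ... | no _     | yes refl rewrite +-identityʳ (g i) | +-comm (f i) 1 = fw₂<gw₂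
  ... | no i≢p   | no _     rewrite +-identityʳ (f i) | +-identityʳ (g i) = f≤g i i≢p
  shifted-strict : f w₁ + δ w₂ w₁ < g w₁ + δ p w₁
  shifted-strict rewrite ==-≢ (≢-sym w₂≢w₁) | ==-≢ w₁≢p | +-identityʳ (f w₁) | +-identityʳ (g w₁) =
    fw₁<gw₁

-- Graphs, connectivity and 2-switches

module _ {n} (G : Graph n) where

  adjacent-sym : ∀ {s t} → Adjacent G s t → Adjacent G t s
  adjacent-sym {s} {t} s~t = trans (adj-sym G t s) s~t

  adjacent⇒≢ : ∀ {s t} → Adjacent G s t → s ≢ t
  adjacent⇒≢ {s} s~s refl = true≢false (trans (sym s~s) (adj-irrefl G s))

  private
    _≺_ : Fin n → Fin n → Bool
    i ≺ j = ⌊ toℕ i <? toℕ j ⌋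

    adj-not-≺ : ∀ i j → adj G i j ∧ not (i ≺ j) ≡ j ≺ i ∧ adj G j i
    adj-not-≺ i j rewrite adj-sym G j i with adj G i j in i~j
    ... | false = sym (∧-zeroʳ (j ≺ i))
    ... | true with toℕ i <? toℕ j | toℕ j <? toℕ i
    ...   | yes i<j | yes j<i = ⊥-elim (<-asym i<j j<i)
    ...   | yes _   | no  _   = refl
    ...   | no  _   | yes _   = refl
    ...   | no  i≮j | no  j≮i with toℕ-injective (≤-antisym (≮⇒≥ j≮i) (≮⇒≥ i≮j))
    ...     | refl = ⊥-elim (adjacent⇒≢ i~j refl)

  handshake : sumFin (degree G) ≡ edgeCount G + edgeCount G
  handshake = begin
    sumFin (degree G)
      ≡⟨ sumFin-cong (λ i → count-split (adj G i) (i ≺_)) ⟩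
    sumFin (λ i → count (λ j → adj G i j ∧ i ≺ j) + count (λ j → adj G i j ∧ not (i ≺ j)))
      ≡⟨ sumFin-+ (λ i → count (λ j → adj G i j ∧ i ≺ j)) (λ i → count (λ j → adj G i j ∧ not (i ≺ j))) ⟩
    sumFin (λ i → count (λ j → adj G i j ∧ i ≺ j)) + sumFin (λ i → count (λ j → adj G i j ∧ not (i ≺ j)))
      ≡⟨ cong₂ _+_ (sumFin-cong (λ i → count-cong (λ j → ∧-comm (adj G i j) (i ≺ j))))
                   (trans (count-transpose (λ i j → adj G i j ∧ not (i ≺ j)))
                          (sumFin-cong (λ j → count-cong (λ i → adj-not-≺ i j)))) ⟩
    edgeCount G + edgeCount G
      ∎
    where open ≡-Reasoning

  Closed : (Fin n → Bool) → Set
  Closed S = ∀ a b → S a ≡ true → Adjacent G a b → S b ≡ true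

  no-closed-cut : Connected G → ∀ {S} → Closed S → ∀ a b → S a ≡ true → S b ≡ false → ⊥
  no-closed-cut conn {S} closed a b Sa Sb = along (conn a b) Sa
    where
    along : ∀ {x} → Star (Adjacent G) x b → S x ≡ true → ⊥
    along ε                      Sx = true≢false (trans (sym Sx) Sb)
    along (_◅_ {j = y} x~y y⋯b) Sx = along y⋯b (closed _ y Sx x~y)

  connected⇒degree-pos : Connected G → ∀ {s t} → s ≢ t → 1 ≤ degree G s
  connected⇒degree-pos conn {s} {t} s≢t with conn s t
  ... | ε       = ⊥-elim (s≢t refl)
  ... | s~k ◅ _ = count-pos (adj G s) s~k

module _ {n : ℕ} where

  pair? : Fin n → Fin n → Fin n → Fin n → Bool
  pair? s t a b = (s == a ∧ t == b) ∨ (s == b ∧ t == a)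

  pair?-flip : ∀ s t a b → pair? s t a b ≡ pair? t s a b
  pair?-flip s t a b rewrite ∧-comm (s == a) (t == b) | ∧-comm (s == b) (t == a) =
    ∨-comm (t == b ∧ s == a) (t == a ∧ s == b)

  pair?-swap : ∀ s t a b → pair? s t a b ≡ pair? s t b a
  pair?-swap s t a b = ∨-comm (s == a ∧ t == b) (s == b ∧ t == a)

  pair?-self : ∀ a b → pair? a b a b ≡ true
  pair?-self a b rewrite ==-refl a | ==-refl b = refl

  pair?-outside : ∀ {s a b} t → s ≢ a → s ≢ b → pair? s t a b ≡ false
  pair?-outside t s≢a s≢b rewrite ==-≢ s≢a | ==-≢ s≢b = refl

  pair?-other : ∀ {a b t} → a ≢ b → t ≢ b → pair? a t a b ≡ false
  pair?-other {a} a≢b t≢b rewrite ==-refl a | ==-≢ a≢b | ==-≢ t≢b = refl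

  pair?-diag : ∀ {a b} s → a ≢ b → pair? s s a b ≡ false
  pair?-diag {a} {b} s a≢b with s ≟ a
  ... | yes refl rewrite ==-≢ a≢b = refl
  ... | no  s≢a  = ∧-zeroʳ (s == b)

  switchAdj : Graph n → (α β γ δ : Fin n) → Fin n → Fin n → Bool
  switchAdj G α β γ δ s t =
    if pair? s t α β ∨ pair? s t γ δ then false
    else if pair? s t α γ ∨ pair? s t β δ then true
    else adj G s t

  module _ (G : Graph n) (α β γ δ : Fin n) where

    switchAdj-sym : ∀ s t → switchAdj G α β γ δ s t ≡ switchAdj G α β γ δ t s
    switchAdj-sym s t
      rewrite pair?-flip s t α β | pair?-flip s t γ δ | pair?-flip s t α γ | pair?-flip s t β δ
            | adj-sym G s t = refl

    switchAdj-irrefl : α ≢ γ → β ≢ δ → ∀ s → switchAdj G α β γ δ s s ≡ false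
    switchAdj-irrefl α≢γ β≢δ s
      rewrite pair?-diag s α≢γ | pair?-diag s β≢δ | adj-irrefl G s
      with pair? s s α β ∨ pair? s s γ δ
    ... | true  = refl
    ... | false = refl

    switchAdj-mirror : ∀ s t → switchAdj G α β γ δ s t ≡ switchAdj G β α δ γ s t
    switchAdj-mirror s t
      rewrite pair?-swap s t α β | pair?-swap s t γ δ | ∨-comm (pair? s t α γ) (pair? s t β δ) = refl

    switchAdj-rotate : ∀ s t → switchAdj G α β γ δ s t ≡ switchAdj G γ δ α β s t
    switchAdj-rotate s t
      rewrite ∨-comm (pair? s t α β) (pair? s t γ δ) | pair?-swap s t α γ | pair?-swap s t β δ = refl

    switchAdj-far : ∀ {s} → s ≢ α → s ≢ β → s ≢ γ → s ≢ δ → ∀ t → switchAdj G α β γ δ s t ≡ adj G s t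
    switchAdj-far s≢α s≢β s≢γ s≢δ t
      rewrite pair?-outside t s≢α s≢β | pair?-outside t s≢γ s≢δ
            | pair?-outside t s≢α s≢γ | pair?-outside t s≢β s≢δ = refl

    module _ (α≢β : α ≢ β) (α≢γ : α ≢ γ) (α≢δ : α ≢ δ) (β≢γ : β ≢ γ) where

      switchAdj-removed : switchAdj G α β γ δ α β ≡ false
      switchAdj-removed rewrite pair?-self α β = refl

      switchAdj-added : switchAdj G α β γ δ α γ ≡ true
      switchAdj-added
        rewrite pair?-other α≢β (≢-sym β≢γ) | pair?-outside γ α≢γ α≢δ | pair?-self α γ = refl

      switchAdj-kept : ∀ {t} → t ≢ β → t ≢ γ → switchAdj G α β γ δ α t ≡ adj G α t
      switchAdj-kept {t} t≢β t≢γ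
        rewrite pair?-other α≢β t≢β | pair?-outside t α≢γ α≢δ
              | pair?-other α≢γ t≢γ | pair?-outside t α≢β α≢δ = refl

module TwoSwitch {n} (G : Graph n) {α β γ δ : Fin n}
  (α≢γ : α ≢ γ) (α≢δ : α ≢ δ) (β≢γ : β ≢ γ) (β≢δ : β ≢ δ)
  (α~β : Adjacent G α β) (γ~δ : Adjacent G γ δ) (α≁γ : adj G α γ ≡ false) (β≁δ : adj G β δ ≡ false)
  where

  private
    α≢β : α ≢ β
    α≢β = adjacent⇒≢ G α~β
    γ≢δ : γ ≢ δ
    γ≢δ = adjacent⇒≢ G γ~δ

  switched : Graph n
  switched = record
    { adj    = switchAdj G α β γ δ
    ; sym    = switchAdj-sym G α β γ δ
    ; irrefl = switchAdj-irrefl G α β γ δ α≢γ β≢δ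
    }

  private
    row-β : ∀ t → adj switched β t ≡ switchAdj G β α δ γ β t
    row-β = switchAdj-mirror G α β γ δ β

    row-γ : ∀ t → adj switched γ t ≡ switchAdj G γ δ α β γ t
    row-γ = switchAdj-rotate G α β γ δ γ

    row-δ : ∀ t → adj switched δ t ≡ switchAdj G δ γ β α δ t
    row-δ t = trans (switchAdj-rotate G α β γ δ δ t) (switchAdj-mirror G γ δ α β δ t)

  α-loses-β : adj switched α β ≡ false
  α-loses-β = switchAdj-removed G α β γ δ α≢β α≢γ α≢δ β≢γ

  α-gains-γ : adj switched α γ ≡ true
  α-gains-γ = switchAdj-added G α β γ δ α≢β α≢γ α≢δ β≢γ

  α-keeps : ∀ {t} → t ≢ β → t ≢ γ → adj switched α t ≡ adj G α t
  α-keeps = switchAdj-kept G α β γ δ α≢β α≢γ α≢δ β≢γ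

  γ-loses-δ : adj switched γ δ ≡ false
  γ-loses-δ = trans (row-γ δ) (switchAdj-removed G γ δ α β γ≢δ (≢-sym α≢γ) (≢-sym β≢γ) (≢-sym α≢δ))

  γ-gains-α : adj switched γ α ≡ true
  γ-gains-α = trans (row-γ α) (switchAdj-added G γ δ α β γ≢δ (≢-sym α≢γ) (≢-sym β≢γ) (≢-sym α≢δ))

  γ-keeps : ∀ {t} → t ≢ δ → t ≢ α → adj switched γ t ≡ adj G γ t
  γ-keeps {t} t≢δ t≢α =
    trans (row-γ t) (switchAdj-kept G γ δ α β γ≢δ (≢-sym α≢γ) (≢-sym β≢γ) (≢-sym α≢δ) t≢δ t≢α)

  switched-degree : ∀ s → degree switched s ≡ degree G s
  switched-degree s = by-cases s (s ≟ α) (s ≟ β) (s ≟ γ) (s ≟ δ)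
    where
    by-cases : ∀ s → Dec (s ≡ α) → Dec (s ≡ β) → Dec (s ≡ γ) → Dec (s ≡ δ) →
      degree switched s ≡ degree G s
    by-cases _ (yes refl) _ _ _ =
      count-exchange α~β α≁γ α-loses-β α-gains-γ (λ _ → α-keeps)
    by-cases _ (no _) (yes refl) _ _ =
      count-exchange (adjacent-sym G α~β) β≁δ
        (trans (row-β α) (switchAdj-removed G β α δ γ (≢-sym α≢β) β≢δ β≢γ α≢δ))
        (trans (row-β δ) (switchAdj-added G β α δ γ (≢-sym α≢β) β≢δ β≢γ α≢δ))
        (λ t t≢α t≢δ → trans (row-β t) (switchAdj-kept G β α δ γ (≢-sym α≢β) β≢δ β≢γ α≢δ t≢α t≢δ))
    by-cases _ (no _) (no _) (yes refl) _ =
      count-exchange γ~δ (trans (adj-sym G γ α) α≁γ) γ-loses-δ γ-gains-α (λ _ → γ-keeps)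
    by-cases _ (no _) (no _) (no _) (yes refl) =
      count-exchange (adjacent-sym G γ~δ) (trans (adj-sym G δ β) β≁δ)
        (trans (row-δ γ) (switchAdj-removed G δ γ β α (≢-sym γ≢δ) (≢-sym β≢δ) (≢-sym α≢δ) (≢-sym β≢γ)))
        (trans (row-δ β) (switchAdj-added G δ γ β α (≢-sym γ≢δ) (≢-sym β≢δ) (≢-sym α≢δ) (≢-sym β≢γ)))
        (λ t t≢γ t≢β → trans (row-δ t)
          (switchAdj-kept G δ γ β α (≢-sym γ≢δ) (≢-sym β≢δ) (≢-sym α≢δ) (≢-sym β≢γ) t≢γ t≢β))
    by-cases s (no s≢α) (no s≢β) (no s≢γ) (no s≢δ) =
      count-cong (switchAdj-far G α β γ δ s≢α s≢β s≢γ s≢δ)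

  switched-realizes : ∀ {D} → Realizes G D → Realizes switched D
  switched-realizes G⊨D s = trans (switched-degree s) (G⊨D s)

  switched-splits-off-αγ : (∀ {t} → Adjacent G α t → t ≡ β) → (∀ {t} → Adjacent G γ t → t ≡ δ) →
    Closed switched (λ t → t == α ∨ t == γ)
  switched-splits-off-αγ only-β only-δ u v Su u~′v = case ((u ≟ α) , (u ≟ γ)) of λ where
      (yes refl , _)        → from-α u~′v
      (no _     , yes refl) → from-γ u~′v
      (no u≢α   , no u≢γ)   → ⊥-elim (true≢false (trans (sym Su) (cong₂ _∨_ (==-≢ u≢α) (==-≢ u≢γ))))
    where
    S : Fin n → Bool
    S t = t == α ∨ t == γ
    Sα : S α ≡ true
    Sα rewrite ==-refl α = refl
    Sγ : S γ ≡ true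
    Sγ rewrite ==-refl γ = ∨-zeroʳ (γ == α)
    from-α : adj switched α v ≡ true → S v ≡ true
    from-α α~′v = case ((v ≟ β) , (v ≟ γ)) of λ where
      (yes refl , _)       → ⊥-elim (true≢false (trans (sym α~′v) α-loses-β))
      (no _     , yes v≡γ) → subst (λ c → S c ≡ true) (sym v≡γ) Sγ
      (no v≢β   , no v≢γ)  → ⊥-elim (v≢β (only-β (trans (sym (α-keeps v≢β v≢γ)) α~′v)))
    from-γ : adj switched γ v ≡ true → S v ≡ true
    from-γ γ~′v = case ((v ≟ δ) , (v ≟ α)) of λ where
      (yes refl , _)       → ⊥-elim (true≢false (trans (sym γ~′v) γ-loses-δ))
      (no _     , yes v≡α) → subst (λ c → S c ≡ true) (sym v≡α) Sα
      (no v≢δ   , no v≢α)  → ⊥-elim (v≢δ (only-δ (trans (sym (γ-keeps v≢δ v≢α)) γ~′v)))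

-- Leaves and excess degrees

module Leaves {n} (D : Fin n → ℕ) where

  isLeaf : Fin n → Bool
  isLeaf v = D v ≡ᵇ 1

  isLeaf⇒≡1 : ∀ {v} → isLeaf v ≡ true → D v ≡ 1
  isLeaf⇒≡1 {v} leaf-v = ≡ᵇ⇒≡ (D v) 1 (Equivalence.from T-≡ leaf-v)

  ≥3⇒¬isLeaf : ∀ {v} → 3 ≤ D v → isLeaf v ≡ false
  ≥3⇒¬isLeaf {v} 3≤Dv with D v | 3≤Dv
  ... | suc (suc (suc _)) | s≤s (s≤s (s≤s _)) = refl

  leaf≢inner : ∀ {a b} → isLeaf a ≡ true → isLeaf b ≡ false → a ≢ b
  leaf≢inner leaf-a inner-b refl = true≢false (trans (sym leaf-a) inner-b)

  leafNbrs innerNbrs : Graph n → Fin n → ℕ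
  leafNbrs  G s = count (λ t → adj G s t ∧ isLeaf t)
  innerNbrs G s = count (λ t → adj G s t ∧ not (isLeaf t))

  excess : Fin n → ℕ
  excess v = D v ∸ 2

  ≥3⇒excess-pos : ∀ {v} → 3 ≤ D v → 1 ≤ excess v
  ≥3⇒excess-pos = ∸-monoˡ-≤ 2

  module Realized (G : Graph n) (G⊨D : Realizes G D) where

    leaf-nbr-unique : ∀ {y a b} → isLeaf y ≡ true → Adjacent G y a → Adjacent G y b → b ≡ a
    leaf-nbr-unique {y} leaf-y = count≡1⇒unique (adj G y) (trans (G⊨D y) (isLeaf⇒≡1 leaf-y))

    degree-split : ∀ s → D s ≡ leafNbrs G s + innerNbrs G s
    degree-split s = trans (sym (G⊨D s)) (count-split (adj G s) isLeaf)

    excess≡leafNbrs+ : ∀ {s} → 2 ≤ innerNbrs G s → excess s ≡ leafNbrs G s + (innerNbrs G s ∸ 2)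
    excess≡leafNbrs+ {s} 2≤inner = trans (cong (_∸ 2) (degree-split s)) (+-∸-assoc (leafNbrs G s) 2≤inner)

    leafNbrs≤excess : ∀ {s} → 2 ≤ innerNbrs G s → leafNbrs G s ≤ excess s
    leafNbrs≤excess {s} 2≤inner =
      subst (leafNbrs G s ≤_) (sym (excess≡leafNbrs+ 2≤inner)) (m≤m+n _ _)

    leafNbrs<excess : ∀ {s} → 3 ≤ innerNbrs G s → leafNbrs G s < excess s
    leafNbrs<excess {s} 3≤inner = subst (leafNbrs G s <_) (sym (excess≡leafNbrs+ (≤-trans (n≤1+n 2) 3≤inner)))
      (subst (_≤ leafNbrs G s + (innerNbrs G s ∸ 2)) (+-comm (leafNbrs G s) 1)
        (+-monoʳ-≤ (leafNbrs G s) (∸-monoˡ-≤ 2 3≤inner)))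

    -- Double counting: each leaf is counted once by its neighbour, and a vertex of degree
    -- d ≥ 1 satisfies d + [d = 1] = 2 + (d ∸ 2).
    Σleaf≡Σexcess : (∀ v → 1 ≤ D v) → sumFin D ≡ n + n → sumFin (leafNbrs G) ≡ sumFin excess
    Σleaf≡Σexcess D-pos ΣD≡2n = begin
      sumFin (leafNbrs G)                                 ≡⟨ count-transpose (λ s t → adj G s t ∧ isLeaf t) ⟩
      sumFin (λ t → count (λ s → adj G s t ∧ isLeaf t))   ≡⟨ sumFin-cong column ⟩
      sumFin [leaf]                                       ≡⟨ +-cancelˡ-≡ (n + n) _ _ total ⟩
      sumFin excess                                       ∎
      where
      open ≡-Reasoning
      [leaf] : Fin n → ℕ
      [leaf] t = if isLeaf t then 1 else 0

      column : ∀ t → count (λ s → adj G s t ∧ isLeaf t) ≡ [leaf] t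
      column t with isLeaf t in leaf-t
      ... | true  = trans (count-cong (λ s → trans (∧-identityʳ _) (adj-sym G s t)))
                          (trans (G⊨D t) (isLeaf⇒≡1 leaf-t))
      ... | false = count-false (λ s → ∧-zeroʳ (adj G s t))

      pointwise : ∀ t → D t + [leaf] t ≡ 2 + excess t
      pointwise t with D t | D-pos t
      ... | 1           | _ = refl
      ... | suc (suc _) | _ = +-identityʳ _

      total : n + n + sumFin [leaf] ≡ n + n + sumFin excess
      total = begin
        n + n + sumFin [leaf]                  ≡⟨ cong (_+ sumFin [leaf]) ΣD≡2n ⟨
        sumFin D + sumFin [leaf]               ≡⟨ sumFin-+ D [leaf] ⟨
        sumFin (λ t → D t + [leaf] t)          ≡⟨ sumFin-cong pointwise ⟩
        sumFin (λ t → 2 + excess t)            ≡⟨ sumFin-+ {n} (λ _ → 2) excess ⟩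
        sumFin {n} (λ _ → 2) + sumFin excess   ≡⟨ cong (_+ sumFin excess) (sumFin-2 n) ⟩
        n + n + sumFin excess                  ∎

-- Four vertices of degree at least 3

module FourHubs {n} (D : Fin n → ℕ)
  (forced : ∀ G → Realizes G D → Connected G) (ΣD≡2n : sumFin D ≡ n + n)
  (hub : Fin 4 → Fin n) (hub-injective : ∀ {k l} → hub k ≡ hub l → k ≡ l)
  (hub-degree : ∀ k → 3 ≤ D (hub k))
  where

  open Leaves D

  p : Fin n
  p = hub 0F

  hub-≢ : ∀ {k l} → k ≢ l → hub k ≢ hub l
  hub-≢ k≢l = k≢l ∘ hub-injective

  hub-inner : ∀ k → isLeaf (hub k) ≡ false
  hub-inner k = ≥3⇒¬isLeaf (hub-degree k)

  record TwoHubsAvoiding (u : Fin n) : Set where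
    field
      k l     : Fin 4
      k≢0     : k ≢ 0F
      l≢0     : l ≢ 0F
      l≢k     : l ≢ k
      hub-k≢u : hub k ≢ u
      hub-l≢u : hub l ≢ u

  two-hubs-avoiding : ∀ u → TwoHubsAvoiding u
  two-hubs-avoiding u with hub 1F ≟ u | hub 2F ≟ u
  ... | yes refl | _ = record
    { k = 2F ; l = 3F ; k≢0 = λ () ; l≢0 = λ () ; l≢k = λ ()
    ; hub-k≢u = hub-≢ λ () ; hub-l≢u = hub-≢ λ () }
  ... | no h₁≢u | yes refl = record
    { k = 1F ; l = 3F ; k≢0 = λ () ; l≢0 = λ () ; l≢k = λ ()
    ; hub-k≢u = h₁≢u ; hub-l≢u = hub-≢ λ () }
  ... | no h₁≢u | no h₂≢u = record
    { k = 1F ; l = 2F ; k≢0 = λ () ; l≢0 = λ () ; l≢k = λ ()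
    ; hub-k≢u = h₁≢u ; hub-l≢u = h₂≢u }

  module Realization (G : Graph n) (G⊨D : Realizes G D) where

    infix 4 _~_
    _~_ : Fin n → Fin n → Set
    s ~ t = Adjacent G s t

    open Realized G G⊨D

    D-pos : ∀ v → 1 ≤ D v
    D-pos v with v ≟ p
    ... | yes refl = subst (1 ≤_) (G⊨D v) (connected⇒degree-pos G (forced G G⊨D) (hub-≢ {0F} {1F} λ ()))
    ... | no  v≢p  = subst (1 ≤_) (G⊨D v) (connected⇒degree-pos G (forced G G⊨D) v≢p)

    leafNbrs≤D : ∀ s → leafNbrs G s ≤ D s
    leafNbrs≤D s = subst (leafNbrs G s ≤_) (sym (degree-split s)) (m≤m+n _ _)

    Σleaf≮Σexcess : ¬ sumFin (leafNbrs G) < sumFin excess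
    Σleaf≮Σexcess = <-irrefl (Σleaf≡Σexcess D-pos ΣD≡2n)

    no-slack : (∀ s → leafNbrs G s ≤ excess s) → ∀ w → ¬ leafNbrs G w < excess w
    no-slack ℓ≤e w ℓw<ew = Σleaf≮Σexcess (sumFin-< ℓ≤e w ℓw<ew)

    no-leaf-nbr : ∀ {s y} → leafNbrs G s ≡ 0 → s ~ y → isLeaf y ≡ true → ⊥
    no-leaf-nbr {s} {y} ℓ≡0 s~y leaf-y =
      true≢false (trans (sym (∧-true⁺ s~y leaf-y)) (count≡0⇒false _ ℓ≡0 y))

    no-inner-nbr : ∀ {s t} → innerNbrs G s ≡ 0 → s ~ t → isLeaf t ≡ false → ⊥
    no-inner-nbr {s} {t} ι≡0 s~t inner-t =
      true≢false (trans (sym (∧-true⁺ s~t (not-true⁺ inner-t))) (count≡0⇒false _ ι≡0 t))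

    inner-nbr-witness : ∀ {s} → 1 ≤ innerNbrs G s → ∃ λ u → s ~ u × isLeaf u ≡ false
    inner-nbr-witness {s} 1≤ι =
      let u , su = count-witness _ 1≤ι
          s~u , not-leaf = ∧-true⁻ {adj G s u} su
      in u , s~u , not-true⁻ not-leaf

    unique-inner-nbr : ∀ {s a b} → innerNbrs G s ≡ 1 →
      s ~ a → isLeaf a ≡ false → s ~ b → isLeaf b ≡ false → b ≡ a
    unique-inner-nbr ι≡1 s~a inner-a s~b inner-b =
      count≡1⇒unique _ ι≡1 (∧-true⁺ s~a (not-true⁺ inner-a)) (∧-true⁺ s~b (not-true⁺ inner-b))

    two-inner-nbrs : ∀ {s a b} → s ~ a → isLeaf a ≡ false → s ~ b → isLeaf b ≡ false → b ≢ a →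
      2 ≤ innerNbrs G s
    two-inner-nbrs s~a inner-a s~b inner-b =
      count-≥2 _ (∧-true⁺ s~a (not-true⁺ inner-a)) (∧-true⁺ s~b (not-true⁺ inner-b))

    leafNbrs≤excess-if-supporting : ∀ {s} →
      (∀ {y} → s ~ y → isLeaf y ≡ true → 2 ≤ innerNbrs G s) → leafNbrs G s ≤ excess s
    leafNbrs≤excess-if-supporting {s} two-inner with count≡0⊎witness (λ t → adj G s t ∧ isLeaf t)
    ... | inj₁ ℓ≡0       = subst (_≤ excess s) (sym ℓ≡0) z≤n
    ... | inj₂ (y , s∼y) = let s~y , leaf-y = ∧-true⁻ {adj G s y} s∼y in leafNbrs≤excess (two-inner s~y leaf-y)

    supports-adjacent : ∀ {x a y b} → isLeaf x ≡ true → isLeaf y ≡ true → x ~ a → y ~ b → a ≢ b → a ~ b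
    supports-adjacent {x} {a} {y} {b} leaf-x leaf-y x~a y~b a≢b with adj G a b in a~?b
    ... | true  = refl
    ... | false = ⊥-elim (no-closed-cut G′ (forced G′ G′⊨D) {S} closed x a Sx Sa)
      where
      x≁y : ¬ x ~ y
      x≁y x~y with leaf-nbr-unique leaf-x x~a x~y | leaf-nbr-unique leaf-y y~b (adjacent-sym G x~y)
      ... | refl | refl = true≢false (trans (sym (adjacent-sym G x~y)) a~?b)
      x≢y : x ≢ y
      x≢y refl = a≢b (leaf-nbr-unique leaf-x y~b x~a)
      x≢b : x ≢ b
      x≢b refl = x≁y (adjacent-sym G y~b)
      a≢y : a ≢ y
      a≢y refl = x≁y x~a
      open TwoSwitch G x≢y x≢b a≢y a≢b x~a y~b (¬-not x≁y) a~?b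
      G′ : Graph n
      G′ = switched
      G′⊨D : Realizes G′ D
      G′⊨D = switched-realizes G⊨D
      S : Fin n → Bool
      S t = t == x ∨ t == y
      closed : Closed G′ S
      closed = switched-splits-off-αγ (leaf-nbr-unique leaf-x x~a) (leaf-nbr-unique leaf-y y~b)
      Sx : S x ≡ true
      Sx rewrite ==-refl x = refl
      Sa : S a ≡ false
      Sa rewrite ==-≢ (≢-sym (adjacent⇒≢ G x~a)) | ==-≢ a≢y = refl

    leaf-gain : ∀ {u y q} → p ~ u → isLeaf u ≡ false → isLeaf y ≡ true → adj G p y ≡ false →
      y ~ q → q ≢ u → adj G u q ≡ false →
      ∃ λ G′ → Realizes G′ D × leafNbrs G′ p ≡ suc (leafNbrs G p)
    leaf-gain {u} {y} {q} p~u inner-u leaf-y p≁y y~q q≢u u≁q =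
      switched , switched-realizes G⊨D ,
      trans (count-erase ℓ′ (∧-true⁺ α-gains-γ leaf-y)) (cong suc (count-cong unchanged))
      where
      p≢q : p ≢ q
      p≢q refl = true≢false (trans (sym (adjacent-sym G y~q)) p≁y)
      open TwoSwitch G (≢-sym (leaf≢inner leaf-y (hub-inner 0F))) p≢q
        (≢-sym (leaf≢inner leaf-y inner-u)) (≢-sym q≢u) p~u y~q p≁y u≁q
      ℓ′ : Fin n → Bool
      ℓ′ t = adj switched p t ∧ isLeaf t
      unchanged : ∀ t → erase y ℓ′ t ≡ (adj G p t ∧ isLeaf t)
      unchanged t = case ((t ≟ y) , (t ≟ u)) of λ where
        (yes refl , _)        → trans (erase-self ℓ′ t) (sym (cong (_∧ isLeaf t) p≁y))
        (no t≢y   , yes refl) →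
          trans (erase-other ℓ′ t≢y) (trans (cong (_∧ isLeaf t) α-loses-β) (sym (cong₂ _∧_ p~u inner-u)))
        (no t≢y   , no t≢u)   → trans (erase-other ℓ′ t≢y) (cong (_∧ isLeaf t) (α-keeps t≢u t≢y))

    NoLeafGain : Set
    NoLeafGain = ∀ {u y q} → p ~ u → isLeaf u ≡ false → isLeaf y ≡ true → adj G p y ≡ false →
      y ~ q → q ≢ u → u ~ q

    leafless-p-impossible : NoLeafGain → leafNbrs G p ≡ 0 → ⊥
    leafless-p-impossible no-gain ℓp≡0 =
      no-slack bounded p (subst (_< excess p) (sym ℓp≡0) (≥3⇒excess-pos (hub-degree 0F)))
      where
      p-hub : 3 ≤ degree G p
      p-hub = subst (3 ≤_) (sym (G⊨D p)) (hub-degree 0F)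
      p-nbr-inner : ∀ {t} → p ~ t → isLeaf t ≡ false
      p-nbr-inner p~t = ¬-not (no-leaf-nbr ℓp≡0 p~t)
      -- By maximality of ℓ(p), every neighbour of p other than s is adjacent to the support vertex s.
      bounded : ∀ s → leafNbrs G s ≤ excess s
      bounded s = leafNbrs≤excess-if-supporting λ {y} s~y leaf-y →
        let a , b , p~a , p~b , a≢s , b≢s , b≢a = count-others (adj G p) s p-hub
            p≁y = ¬-not (λ p~y → no-leaf-nbr ℓp≡0 p~y leaf-y)
            joins-s : ∀ {c} → p ~ c → c ≢ s → s ~ c
            joins-s p~c c≢s = adjacent-sym G
              (no-gain p~c (p-nbr-inner p~c) leaf-y p≁y (adjacent-sym G s~y) (≢-sym c≢s))
        in two-inner-nbrs (joins-s p~a a≢s) (p-nbr-inner p~a) (joins-s p~b b≢s) (p-nbr-inner p~b) b≢a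

    module LeafAtP (no-gain : NoLeafGain) {x₀} (p~x₀ : p ~ x₀) (leaf-x₀ : isLeaf x₀ ≡ true) where

      support-joins-p : ∀ {s y} → s ≢ p → s ~ y → isLeaf y ≡ true →
        p ~ s × isLeaf s ≡ false × adj G p y ≡ false
      support-joins-p {s} {y} s≢p s~y leaf-y = p~s , inner-s , p≁y
        where
        p~s : p ~ s
        p~s = supports-adjacent leaf-x₀ leaf-y (adjacent-sym G p~x₀) (adjacent-sym G s~y) (≢-sym s≢p)
        inner-s : isLeaf s ≡ false
        inner-s = ¬-not λ leaf-s →
          leaf≢inner leaf-y (hub-inner 0F) (sym (leaf-nbr-unique leaf-s s~y (adjacent-sym G p~s)))
        p≁y : adj G p y ≡ false
        p≁y = ¬-not λ p~y → s≢p (sym (leaf-nbr-unique leaf-y (adjacent-sym G s~y) (adjacent-sym G p~y)))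

      leafless-off-p : ∀ {s} → s ≢ p → adj G p s ≡ false → leafNbrs G s ≡ 0
      leafless-off-p {s} s≢p p≁s with count≡0⊎witness (λ t → adj G s t ∧ isLeaf t)
      ... | inj₁ ℓ≡0       = ℓ≡0
      ... | inj₂ (y , s∼y) =
        let s~y , leaf-y = ∧-true⁻ {adj G s y} s∼y
        in ⊥-elim (true≢false (trans (sym (proj₁ (support-joins-p s≢p s~y leaf-y))) p≁s))

      slack-off-p : ∀ k → adj G p (hub k) ≡ false → k ≢ 0F → leafNbrs G (hub k) < excess (hub k)
      slack-off-p k p≁w k≢0 =
        subst (_< excess (hub k)) (sym (leafless-off-p (hub-≢ k≢0) p≁w)) (≥3⇒excess-pos (hub-degree k))

      Core : Fin n → Bool
      Core t = t == p ∨ (adj G p t ∧ not (isLeaf t))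

      Core-p : Core p ≡ true
      Core-p rewrite ==-refl p = refl

      Core-inner-nbr : ∀ {t} → p ~ t → isLeaf t ≡ false → Core t ≡ true
      Core-inner-nbr {t} p~t inner-t rewrite p~t | inner-t = ∨-zeroʳ (t == p)

      -- The core and the leaves form a union of components, so no hub may lie outside the core.
      closed-core-impossible :
        (∀ {u t} → p ~ u → isLeaf u ≡ false → u ~ t → isLeaf t ≡ false → Core t ≡ true) →
        ∀ {w} → 3 ≤ D w → w ≢ p → adj G p w ≡ false → ⊥
      closed-core-impossible core-closed {w} hub-w w≢p p≁w =
        no-closed-cut G (forced G G⊨D) {S} closed p w Sp Sw
        where
        S : Fin n → Bool
        S t = Core t ∨ isLeaf t
        Sp : S p ≡ true
        Sp = cong (_∨ isLeaf p) Core-p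
        Sw : S w ≡ false
        Sw rewrite ==-≢ w≢p | p≁w | ≥3⇒¬isLeaf hub-w = refl
        Core-nbr : ∀ {a b} → S a ≡ true → a ~ b → isLeaf b ≡ false → Core b ≡ true
        Core-nbr {a} {b} Sa a~b inner-b with ∨-true⁻ {Core a} Sa
        ... | inj₂ leaf-a = case b ≟ p of λ where
          (yes refl) → Core-p
          (no b≢p)   → Core-inner-nbr (proj₁ (support-joins-p b≢p (adjacent-sym G a~b) leaf-a)) inner-b
        Core-nbr {a} {b} Sa a~b inner-b | inj₁ core-a with ∨-true⁻ {a == p} core-a
        ... | inj₁ a≡p = Core-inner-nbr (subst (_~ b) (==⇒≡ a≡p) a~b) inner-b
        ... | inj₂ p∼a = let p~a , not-leaf = ∧-true⁻ {adj G p a} p∼a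
                         in core-closed p~a (not-true⁻ not-leaf) a~b inner-b
        closed : Closed G S
        closed a b Sa a~b = case isLeaf b ≟ᵇ true of λ where
          (yes leaf-b) → trans (cong (Core b ∨_) leaf-b) (∨-zeroʳ (Core b))
          (no ¬leaf-b) → cong (_∨ isLeaf b) (Core-nbr Sa a~b (¬-not ¬leaf-b))

      p-without-inner-nbr : innerNbrs G p ≡ 0 → ⊥
      p-without-inner-nbr ι≡0 =
        closed-core-impossible (λ p~u inner-u _ _ → ⊥-elim (no-inner-nbr ι≡0 p~u inner-u))
          (hub-degree 1F) (hub-≢ λ ()) (¬-not λ p~f → no-inner-nbr ι≡0 p~f (hub-inner 1F))

      module OneInnerNbr (ι≡1 : innerNbrs G p ≡ 1) {u} (p~u : p ~ u) (inner-u : isLeaf u ≡ false) where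

        only-u : ∀ {t} → p ~ t → isLeaf t ≡ false → t ≡ u
        only-u p~t inner-t = unique-inner-nbr ι≡1 p~u inner-u p~t inner-t

        p≁hub : ∀ k → hub k ≢ u → adj G p (hub k) ≡ false
        p≁hub k hub-k≢u = ¬-not λ p~w → hub-k≢u (only-u p~w (hub-inner k))

        open TwoHubsAvoiding (two-hubs-avoiding u)

        u-with-one-inner-nbr : innerNbrs G u ≡ 1 → ⊥
        u-with-one-inner-nbr ιu≡1 =
          closed-core-impossible core-closed (hub-degree k) (hub-≢ k≢0) (p≁hub k hub-k≢u)
          where
          core-closed : ∀ {u′ t} → p ~ u′ → isLeaf u′ ≡ false → u′ ~ t → isLeaf t ≡ false → Core t ≡ true
          core-closed p~u′ inner-u′ u′~t inner-t with only-u p~u′ inner-u′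
          ... | refl = subst (λ c → Core c ≡ true)
                         (sym (unique-inner-nbr ιu≡1 (adjacent-sym G p~u) (hub-inner 0F) u′~t inner-t)) Core-p

        -- The surplus of one leaf at p is outweighed by the slack at two hubs outside N[p].
        u-with-many-inner-nbrs : 2 ≤ innerNbrs G u → ⊥
        u-with-many-inner-nbrs 2≤ιu = Σleaf≮Σexcess (sumFin-<-despite-surplus bounded surplus
          (hub-≢ k≢0) (hub-≢ l≢0) (hub-≢ l≢k)
          (slack-off-p k (p≁hub k hub-k≢u) k≢0) (slack-off-p l (p≁hub l hub-l≢u) l≢0))
          where
          bounded : ∀ s → s ≢ p → leafNbrs G s ≤ excess s
          bounded s s≢p = leafNbrs≤excess-if-supporting λ s~y leaf-y →
            let p~s , inner-s , _ = support-joins-p s≢p s~y leaf-y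
            in subst (λ c → 2 ≤ innerNbrs G c) (sym (only-u p~s inner-s)) 2≤ιu
          surplus : leafNbrs G p ≤ suc (excess p)
          surplus = subst (λ d → leafNbrs G p ≤ suc (d ∸ 2))
            (sym (trans (degree-split p) (trans (cong (leafNbrs G p +_) ι≡1) (+-comm (leafNbrs G p) 1))))
            (m≤n+m∸n (leafNbrs G p) 1)

        impossible : ⊥
        impossible with 2 ≤? innerNbrs G u
        ... | yes 2≤ιu = u-with-many-inner-nbrs 2≤ιu
        ... | no  2≰ιu = u-with-one-inner-nbr (≤-antisym (≤-pred (≰⇒> 2≰ιu))
          (count-pos (λ t → adj G u t ∧ not (isLeaf t)) (∧-true⁺ (adjacent-sym G p~u) (not-true⁺ (hub-inner 0F)))))

      module ManyInnerNbrs (2≤ιp : 2 ≤ innerNbrs G p) where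

        -- By maximality of ℓ(p), every inner neighbour of p other than s is adjacent to the
        -- support vertex s ≠ p.
        bounded : ∀ s → leafNbrs G s ≤ excess s
        bounded s = case s ≟ p of λ where
          (yes refl) → leafNbrs≤excess 2≤ιp
          (no s≢p)   → leafNbrs≤excess-if-supporting λ s~y leaf-y →
            let p~s , inner-s , p≁y = support-joins-p s≢p s~y leaf-y
                u , pu , u≢s = count-other _ s 2≤ιp
                p~u , not-leaf-u = ∧-true⁻ {adj G p u} pu
                inner-u = not-true⁻ not-leaf-u
                u~s = no-gain p~u inner-u leaf-y p≁y (adjacent-sym G s~y) (≢-sym u≢s)
            in two-inner-nbrs (adjacent-sym G p~s) (hub-inner 0F) (adjacent-sym G u~s) inner-u
                 (≢-sym (adjacent⇒≢ G p~u))

        inner-hub : ∀ k → p ~ hub k → adj G p (hub k) ∧ not (isLeaf (hub k)) ≡ true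
        inner-hub k p~w = ∧-true⁺ p~w (not-true⁺ (hub-inner k))

        impossible : ⊥
        impossible with adj G p (hub 1F) in p?₁ | adj G p (hub 2F) in p?₂ | adj G p (hub 3F) in p?₃
        ... | false | _     | _     = no-slack bounded (hub 1F) (slack-off-p 1F p?₁ λ ())
        ... | true  | false | _     = no-slack bounded (hub 2F) (slack-off-p 2F p?₂ λ ())
        ... | true  | true  | false = no-slack bounded (hub 3F) (slack-off-p 3F p?₃ λ ())
        ... | true  | true  | true  = no-slack bounded p (leafNbrs<excess
              (count-≥3 _ (inner-hub 1F p?₁) (inner-hub 2F p?₂) (inner-hub 3F p?₃)
                (hub-≢ λ ()) (hub-≢ λ ()) (hub-≢ λ ())))

      impossible : ⊥
      impossible with innerNbrs G p in ιp
      ... | 0           = p-without-inner-nbr ιp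
      ... | 1           = let u , p~u , inner-u = inner-nbr-witness (≤-reflexive (sym ιp))
                          in OneInnerNbr.impossible ιp p~u inner-u
      ... | suc (suc _) = ManyInnerNbrs.impossible (subst (2 ≤_) (sym ιp) (s≤s (s≤s z≤n)))

    no-leaf-gain-impossible : NoLeafGain → ⊥
    no-leaf-gain-impossible no-gain with count≡0⊎witness (λ t → adj G p t ∧ isLeaf t)
    ... | inj₁ ℓp≡0        = leafless-p-impossible no-gain ℓp≡0
    ... | inj₂ (x₀ , p∼x₀) = let p~x₀ , leaf-x₀ = ∧-true⁻ {adj G p x₀} p∼x₀
                             in LeafAtP.impossible no-gain p~x₀ leaf-x₀

  -- Induction on the slack D p ∸ leafNbrs G p, which every leaf gain decreases.
  climb : ∀ k G → Realizes G D → leafNbrs G p + k ≡ D p → ⊥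
  no-gain-beyond : ∀ k G G′ → leafNbrs G p + k ≡ D p → Realizes G′ D → leafNbrs G′ p ≡ suc (leafNbrs G p) → ⊥

  climb k G G⊨D ℓ+k≡D = no-leaf-gain-impossible no-gain
    where
    open Realization G G⊨D
    no-gain : NoLeafGain
    no-gain {u} {q = q} p~u inner-u leaf-y p≁y y~q q≢u with adj G u q in u?q
    ... | true  = refl
    ... | false = let G′ , G′⊨D , ℓ′≡1+ℓ = leaf-gain p~u inner-u leaf-y p≁y y~q q≢u u?q
                  in ⊥-elim (no-gain-beyond k G G′ ℓ+k≡D G′⊨D ℓ′≡1+ℓ)

  no-gain-beyond zero G G′ ℓ+0≡D G′⊨D ℓ′≡1+ℓ = 1+n≰n (begin
    suc (leafNbrs G p)   ≡⟨ ℓ′≡1+ℓ ⟨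
    leafNbrs G′ p        ≤⟨ Realization.leafNbrs≤D G′ G′⊨D p ⟩
    D p                  ≡⟨ ℓ+0≡D ⟨
    leafNbrs G p + 0     ≡⟨ +-identityʳ _ ⟩
    leafNbrs G p         ∎)
    where open ≤-Reasoning
  no-gain-beyond (suc k) G G′ ℓ+1+k≡D G′⊨D ℓ′≡1+ℓ =
    climb k G′ G′⊨D (trans (cong (_+ k) ℓ′≡1+ℓ) (trans (sym (+-suc _ k)) ℓ+1+k≡D))

  no-realization : ∀ G → Realizes G D → ⊥
  no-realization G G⊨D = climb (D p ∸ leafNbrs G p) G G⊨D (m+[n∸m]≡n (Realization.leafNbrs≤D G G⊨D p))

lemma3p5 : (n : ℕ) → 6 ≤ n → (D : Fin n → ℕ) → NonIncreasing D →
    ForciblyUnicyclic D → (i : Fin n) → toℕ i ≡ 3 → D i ≤ 2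
lemma3p5 _ (s≤s (s≤s (s≤s (s≤s {n = m} _)))) D non-increasing ((G₀ , G₀⊨D) , forced) i i≡3
  with D i ≤? 2
... | yes Di≤2 = Di≤2
... | no  Di≰2 = ⊥-elim (FourHubs.no-realization D (λ G G⊨D → proj₁ (forced G G⊨D)) ΣD≡2n
                           (_↑ˡ m) (↑ˡ-injective m _ _) leading-hubs G₀ G₀⊨D)
  where
  ΣD≡2n : sumFin D ≡ (4 + m) + (4 + m)
  ΣD≡2n = begin
    sumFin D                    ≡⟨ sumFin-cong G₀⊨D ⟨
    sumFin (degree G₀)          ≡⟨ handshake G₀ ⟩
    edgeCount G₀ + edgeCount G₀ ≡⟨ cong (λ e → e + e) (proj₂ (forced G₀ G₀⊨D)) ⟩
    (4 + m) + (4 + m)           ∎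
    where open ≡-Reasoning
  leading-hubs : ∀ k → 3 ≤ D (k ↑ˡ m)
  leading-hubs k = ≤-trans (≰⇒> Di≰2) (non-increasing (k ↑ˡ m) i (begin
    toℕ (k ↑ˡ m)  ≡⟨ toℕ-↑ˡ k m ⟩
    toℕ k         ≤⟨ toℕ≤pred[n] k ⟩
    3             ≡⟨ i≡3 ⟨
    toℕ i         ∎))
    where open ≤-Reasoning
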